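{- For all integers $k\ge2$ and $m,n\ge0$, let $$H(k,m,n)=\frac{(km+(k+1)(n+1))!}{(k(m+n+1)+1)(m+n+1)\,((k-1)m+k(n+1))!\,m!\,n!}.$$ Then $G(m\vec k+n(\overrightarrow{k+1}))=H(k,m,n)$, i.e. the coefficient of $t_k^m t_{k+1}^n$ in the Geode $\mathbf G$ equals $H(k,m,n)$.
   Context: A type is a vector $\mathbf m=[m_2,m_3,\ldots]$ of natural numbers (indices start at $2$) with finitely many nonzero entries; $\vec j$ is the type with $1$ in position $j$ and $0$ elsewhere, and $\mathbf t^{\mathbf m}=t_2^{m_2}t_3^{m_3}\cdots$. The hyper-Catalan number is $C_{\mathbf m}=\frac{(2m_2+3m_3+4m_4+\cdots)!}{(1+m_2+2m_3+3m_4+\cdots)!\,m_2!\,m_3!\cdots}$ and $\mathbf S=\sum_{\mathbf m}C_{\mathbf m}\mathbf t^{\mathbf m}$. The Geode $\mathbf G$ is the unique formal power series with $\mathbf S-1=(t_2+t_3+t_4+\cdots)\mathbf G$, and $G(\mathbf n)$ is its coefficient of $\mathbf t^{\mathbf n}$. -}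

module Defs where

open import Data.Nat using (ℕ; zero; suc; _+_; _*_; _∸_; _!; NonZero)
open import Data.Nat.Properties using (m*n≢0; _!≢0; _!*_!≢0)
open import Data.Integer using (+_)
open import Data.List using (List; []; _∷_; _++_; [_]; replicate)
open import Relation.Binary.PropositionalEquality using (_≡_)
open import Data.Bool using (Bool; true; false; not)
open import Data.Rational using (ℚ; _/_) renaming (_+_ to _+ℚ_; 0ℚ to 0ℚ)

-- A type m = [m₂, m₃, …] is represented by a finite list
--   (m₂ ∷ m₃ ∷ … ∷ m_{L+1} ∷ [])
-- (list position i ↔ index i+2); trailing zeros are insignificant.
Type : Set
Type = List ℕ

isZeroType : Type → Bool
isZeroType []           = true
isZeroType (zero ∷ xs)  = isZeroType xs
isZeroType (suc _ ∷ xs) = false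

weighted : ℕ → Type → ℕ
weighted c []       = 0
weighted c (x ∷ xs) = c * x + weighted (suc c) xs

numDeg : Type → ℕ
numDeg = weighted 2

denDeg : Type → ℕ
denDeg m = 1 + weighted 1 m

factProd : Type → ℕ
factProd []       = 1
factProd (x ∷ xs) = x ! * factProd xs

factProd≢0 : ∀ m → NonZero (factProd m)
factProd≢0 []       = _
factProd≢0 (x ∷ xs) = m*n≢0 (x !) (factProd xs) {{x !≢0}} {{factProd≢0 xs}}

-- hyper-Catalan number C_m (as a rational; it is in fact an integer)
hyperCatalan : Type → ℚ
hyperCatalan m =
  _/_ (+ (numDeg m !)) (denDeg m ! * factProd m)
      {{m*n≢0 (denDeg m !) (factProd m) {{denDeg m !≢0}} {{factProd≢0 m}}}}

-- Σ_{j ≥ 2, m_j ≥ 1} G(m − e_j) : coefficient of t^m in (t₂ + t₃ + ⋯) G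
shiftSumAux : (Type → ℚ) → Type → Type → ℚ
shiftSumAux G pre []            = 0ℚ
shiftSumAux G pre (zero ∷ r)    = shiftSumAux G (pre ++ [ zero ]) r
shiftSumAux G pre (suc a ∷ r)   = G (pre ++ a ∷ r) +ℚ shiftSumAux G (pre ++ [ suc a ]) r

shiftSum : (Type → ℚ) → Type → ℚ
shiftSum G m = shiftSumAux G [] m

-- G : Type → ℚ is (the coefficient function of) a Geode:
--   G is a well-defined function of types (insensitive to trailing zeros), and
--   S − 1 = (t₂ + t₃ + ⋯) G coefficientwise: for every nonzero type m,
--   C_m = Σ_{j, m_j ≥ 1} G(m − e_j)  (at m = 0 both sides are 0).
record IsGeode (G : Type → ℚ) : Set where
  field
    trailingZero : ∀ m → G (m ++ [ zero ]) ≡ G m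
    geodeEq      : ∀ m → isZeroType m ≡ false → hyperCatalan m ≡ shiftSum G m

-- the type m·(vec k) + n·(vec (k+1))  (for k ≥ 2)
typeKK1 : ℕ → ℕ → ℕ → Type
typeKK1 k m n = replicate (k ∸ 2) zero ++ (m ∷ n ∷ [])

nz+1 : ∀ x → NonZero (x + 1)
nz+1 zero    = _
nz+1 (suc x) = _

Hden : ℕ → ℕ → ℕ → ℕ
Hden k m n = (k * (m + n + 1) + 1) * (m + n + 1) * (((k ∸ 1) * m + k * (n + 1)) ! * m ! * n !)

Hden≢0 : ∀ k m n → NonZero (Hden k m n)
Hden≢0 k m n =
  m*n≢0 _ _ {{m*n≢0 _ _ {{nz+1 (k * (m + n + 1))}} {{nz+1 (m + n)}}}}
            {{m*n≢0 _ _ {{(((k ∸ 1) * m + k * (n + 1)) !* m !≢0)}} {{n !≢0}}}}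

H : ℕ → ℕ → ℕ → ℚ
H k m n = _/_ (+ ((k * m + (k + 1) * (n + 1)) !)) (Hden k m n) {{Hden≢0 k m n}}

-- Write T(a,b) for the type a·e_k + b·e_(k+1). The Geode equation at T(m+1,n+1) reads
-- C(T(m+1,n+1)) = G(T(m,n+1)) + G(T(m+1,n)), and at T(m+1,0) it reads C(T(m+1,0)) = G(T(m,0)).
-- Together they determine G on T(·,·) by induction on n, so it suffices that H satisfies the
-- same two relations. After clearing denominators both reduce to an identity between the degrees
-- N = k a + (k+1) b and D = 1 + (k-1) a + k b of T(a,b):
--   (N + 1) a + D b = (k (a + b) + 1) (a + b).
module Submission where

open import Defs
open import Data.Nat using (ℕ; zero; suc; _+_; _*_; _≤_; _!; NonZero; s≤s; z≤n)
open import Data.Nat.Properties using (m*n≢0; _!≢0; _!*_!≢0; *-zeroʳ; *-identityʳ; +-identityʳ; +-suc; +-comm)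
open import Data.Nat.Tactic.RingSolver using (solve-∀)
open import Data.Integer as ℤ using (+_)
import Data.Integer.Properties as ℤ
open import Data.List using ([]; _∷_; _++_; [_]; replicate)
open import Data.List.Properties using (++-assoc; ++-identityʳ)
open import Data.Bool using (false)
open import Data.Rational using (ℚ; _/_; 0ℚ; toℚᵘ) renaming (_+_ to _+ℚ_)
import Data.Rational.Properties as ℚ
import Data.Rational.Unnormalised as ℚᵘ
import Data.Rational.Unnormalised.Properties as ℚᵘ
open import Algebra.Properties.Group ℚ.+-0-group using (∙-cancelʳ)
open import Relation.Binary.PropositionalEquality
  using (_≡_; refl; sym; trans; cong; cong₂; module ≡-Reasoning)

/-cross : ∀ a b c d .{{_ : NonZero b}} .{{_ : NonZero d}} →
          a * d ≡ c * b → + a / b ≡ + c / d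
/-cross a (suc b) c (suc d) eq =
  ℚ.fromℚᵘ-cong {ℚᵘ.mkℚᵘ (+ a) b} {ℚᵘ.mkℚᵘ (+ c) d}
    (ℚᵘ.*≡* (trans (sym (ℤ.pos-* a (suc d))) (trans (cong +_ eq) (ℤ.pos-* c (suc b)))))

/-+-/ : ∀ a b c d .{{_ : NonZero b}} .{{_ : NonZero d}} →
        + a / b +ℚ + c / d ≡ (+ (a * d + c * b) / (b * d)) {{m*n≢0 b d}}
/-+-/ a (suc b) c (suc d) = ℚ.toℚᵘ-injective {+ a / suc b +ℚ + c / suc d} (begin
  toℚᵘ (+ a / suc b +ℚ + c / suc d)
    ≈⟨ ℚ.toℚᵘ-homo-+ (+ a / suc b) (+ c / suc d) ⟩
  toℚᵘ (+ a / suc b) ℚᵘ.+ toℚᵘ (+ c / suc d)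
    ≈⟨ ℚᵘ.+-cong (ℚ.toℚᵘ-fromℚᵘ (ℚᵘ.mkℚᵘ (+ a) b)) (ℚ.toℚᵘ-fromℚᵘ (ℚᵘ.mkℚᵘ (+ c) d)) ⟩
  ℚᵘ.mkℚᵘ (+ a) b ℚᵘ.+ ℚᵘ.mkℚᵘ (+ c) d
    ≡⟨ cong (λ i → ℚᵘ.mkℚᵘ i (d + b * suc d)) numerator ⟩
  ℚᵘ.mkℚᵘ (+ (a * suc d + c * suc b)) (d + b * suc d)
    ≈⟨ ℚ.toℚᵘ-fromℚᵘ (ℚᵘ.mkℚᵘ (+ (a * suc d + c * suc b)) (d + b * suc d)) ⟨
  toℚᵘ (+ (a * suc d + c * suc b) / (suc b * suc d)) ∎)
  where
  open ℚᵘ.≃-Reasoning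
  numerator : + a ℤ.* + suc d ℤ.+ + c ℤ.* + suc b ≡ + (a * suc d + c * suc b)
  numerator = trans (cong₂ ℤ._+_ (sym (ℤ.pos-* a (suc d))) (sym (ℤ.pos-* c (suc b))))
                    (sym (ℤ.pos-+ (a * suc d) (c * suc b)))

weighted-zeros : ∀ j c r → weighted c (replicate j zero ++ r) ≡ weighted (c + j) r
weighted-zeros zero    c r = cong (λ c′ → weighted c′ r) (sym (+-identityʳ c))
weighted-zeros (suc j) c r = begin
  c * 0 + weighted (suc c) (replicate j zero ++ r)
    ≡⟨ cong (_+ weighted (suc c) (replicate j zero ++ r)) (*-zeroʳ c) ⟩
  weighted (suc c) (replicate j zero ++ r)         ≡⟨ weighted-zeros j (suc c) r ⟩
  weighted (suc c + j) r                           ≡⟨ cong (λ c′ → weighted c′ r) (+-suc c j) ⟨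
  weighted (c + suc j) r                           ∎
  where open ≡-Reasoning

weighted-shift : ∀ c xs a b r →
  weighted c (xs ++ a ∷ suc b ∷ r) ≡ suc (weighted c (xs ++ suc a ∷ b ∷ r))
weighted-shift c [] a b r = shift c a b (weighted (suc (suc c)) r)
  where
  shift : ∀ c a b w → c * a + (suc c * suc b + w) ≡ suc (c * suc a + (suc c * b + w))
  shift = solve-∀
weighted-shift c (x ∷ xs) a b r =
  trans (cong (_+_ (c * x)) (weighted-shift (suc c) xs a b r)) (+-suc (c * x) _)

factProd-zeros : ∀ j r → factProd (replicate j zero ++ r) ≡ factProd r
factProd-zeros zero    r = refl
factProd-zeros (suc j) r = trans (+-identityʳ _) (factProd-zeros j r)

isZeroType-++-suc : ∀ xs a r → isZeroType (xs ++ suc a ∷ r) ≡ false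
isZeroType-++-suc []           a r = refl
isZeroType-++-suc (zero ∷ xs)  a r = isZeroType-++-suc xs a r
isZeroType-++-suc (suc _ ∷ xs) a r = refl

shiftSumAux-zeros : ∀ G j pre r →
  shiftSumAux G pre (replicate j zero ++ r) ≡ shiftSumAux G (pre ++ replicate j zero) r
shiftSumAux-zeros G zero    pre r = cong (λ p → shiftSumAux G p r) (sym (++-identityʳ pre))
shiftSumAux-zeros G (suc j) pre r =
  trans (shiftSumAux-zeros G j (pre ++ [ zero ]) r)
        (cong (λ p → shiftSumAux G p r) (++-assoc pre [ zero ] (replicate j zero)))

factProd-typeKK1 : ∀ j a b → factProd (typeKK1 (2 + j) a b) ≡ a ! * b !
factProd-typeKK1 j a b = trans (factProd-zeros j (a ∷ b ∷ [])) (cong (a ! *_) (*-identityʳ (b !)))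

hyperCatalan-typeKK1 : ∀ j a b → let T = typeKK1 (2 + j) a b in
  hyperCatalan T
  ≡ (+ (numDeg T !) / (denDeg T ! * (a ! * b !))) {{m*n≢0 _ _ {{denDeg T !≢0}} {{a !* b !≢0}}}}
hyperCatalan-typeKK1 j a b =
  ℚ./-cong {+ (numDeg T !)} {denDeg T ! * factProd T} {+ (numDeg T !)} {denDeg T ! * (a ! * b !)}
    {{m*n≢0 _ _ {{denDeg T !≢0}} {{factProd≢0 T}}}} {{m*n≢0 _ _ {{denDeg T !≢0}} {{a !* b !≢0}}}}
    refl (cong (denDeg T ! *_) (factProd-typeKK1 j a b))
  where T = typeKK1 (2 + j) a b

degree-identity : ∀ j a b → let T = typeKK1 (2 + j) a b in
  suc (numDeg T) * a + denDeg T * b ≡ ((2 + j) * (a + b) + 1) * (a + b)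
degree-identity j a b = begin
  suc (weighted 2 T) * a + suc (weighted 1 T) * b
    ≡⟨ cong₂ (λ x y → suc x * a + suc y * b)
         (weighted-zeros j 2 (a ∷ b ∷ [])) (weighted-zeros j 1 (a ∷ b ∷ [])) ⟩
  suc (weighted (2 + j) (a ∷ b ∷ [])) * a + suc (weighted (1 + j) (a ∷ b ∷ [])) * b
    ≡⟨ polynomial j a b ⟩
  ((2 + j) * (a + b) + 1) * (a + b) ∎
  where
  open ≡-Reasoning
  T = typeKK1 (2 + j) a b
  polynomial : ∀ j a b →
    suc ((2 + j) * a + (suc (2 + j) * b + 0)) * a + suc ((1 + j) * a + (suc (1 + j) * b + 0)) * b
    ≡ ((2 + j) * (a + b) + 1) * (a + b)
  polynomial = solve-∀

-- H k m n with t = m + n + 1 and the two factorial arguments x, y abstracted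
H′-den : (k t y a b : ℕ) → ℕ
H′-den k t y a b = (k * t + 1) * t * (y ! * a ! * b !)

H′-den≢0 : ∀ k t y a b .{{_ : NonZero t}} → NonZero (H′-den k t y a b)
H′-den≢0 k t y a b = m*n≢0 _ _ {{m*n≢0 _ _ {{nz+1 (k * t)}}}} {{m*n≢0 _ _ {{y !* a !≢0}} {{b !≢0}}}}

H′ : (k t x y a b : ℕ) .{{_ : NonZero t}} → ℚ
H′ k t x y a b = (+ (x !) / H′-den k t y a b) {{H′-den≢0 k t y a b}}

H′-cong : ∀ k {t t′ x x′ y y′} a b .{{_ : NonZero t}} .{{_ : NonZero t′}} →
          t ≡ t′ → x ≡ x′ → y ≡ y′ → H′ k t x y a b ≡ H′ k t′ x′ y′ a b
H′-cong k a b refl refl refl = refl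

H≡H′ : ∀ j m n → let T = typeKK1 (2 + j) m (suc n) in
  H (2 + j) m n ≡ H′ (2 + j) (suc (m + n)) (numDeg T) (weighted 1 T) m n
H≡H′ j m n = H′-cong (2 + j) m n {{nz+1 (m + n)}}
  (+-comm (m + n) 1)
  (trans (num (2 + j) m n) (sym (weighted-zeros j 2 (m ∷ suc n ∷ []))))
  (trans (den (1 + j) m n) (sym (weighted-zeros j 1 (m ∷ suc n ∷ []))))
  where
  num : ∀ c m n → c * m + (c + 1) * (n + 1) ≡ c * m + (suc c * suc n + 0)
  num = solve-∀
  den : ∀ c m n → c * m + suc c * (n + 1) ≡ c * m + (suc c * suc n + 0)
  den = solve-∀

H-base-cleared : ∀ N W m X Y P {S} → suc N * suc m + suc W * 0 ≡ S →
  suc N * X * (suc W * Y * (suc m * P * 1)) ≡ X * (S * (suc W * Y * P * 1))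
H-base-cleared N W m X Y P refl = polynomial N W m X Y P
  where
  polynomial : ∀ N W m X Y P →
    suc N * X * (suc W * Y * (suc m * P * 1))
    ≡ X * ((suc N * suc m + suc W * 0) * (suc W * Y * P * 1))
  polynomial = solve-∀

-- H(k,m,n+1) + H(k,m+1,n) = C(T(m+1,n+1)) cleared of denominators: N, W + 1 are the degrees of
-- T(m+1,n+1), X, Y, P, Q stand for N!, W!, m!, n!, and S for (k (m + n + 2) + 1) (m + n + 2).
H-step-cleared : ∀ N W m n X Y P Q {S} → suc N * suc m + suc W * suc n ≡ S →
  (suc N * X * (S * (Y * (suc m * P) * Q)) + X * (S * (suc W * Y * P * (suc n * Q))))
    * (suc W * Y * (suc m * P * (suc n * Q)))
  ≡ X * (S * (suc W * Y * P * (suc n * Q)) * (S * (Y * (suc m * P) * Q)))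
H-step-cleared N W m n X Y P Q refl = polynomial N W m n X Y P Q
  where
  polynomial : ∀ N W m n X Y P Q → let S = suc N * suc m + suc W * suc n in
    (suc N * X * (S * (Y * (suc m * P) * Q)) + X * (S * (suc W * Y * P * (suc n * Q))))
      * (suc W * Y * (suc m * P * (suc n * Q)))
    ≡ X * (S * (suc W * Y * P * (suc n * Q)) * (S * (Y * (suc m * P) * Q)))
  polynomial = solve-∀

H-base : ∀ j m → H (2 + j) m 0 ≡ hyperCatalan (typeKK1 (2 + j) (suc m) 0)
H-base j m = begin
  H k m 0
    ≡⟨ trans (H≡H′ j m 0)
         (H′-cong k {suc (m + 0)} m 0 refl (weighted-shift 2 zs m 0 []) (weighted-shift 1 zs m 0 [])) ⟩
  + (suc N !) / d₁
    ≡⟨ /-cross (suc N !) d₁ (N !) d₂ (H-base-cleared N W m (N !) (W !) (m !) (degree-identity j (suc m) 0)) ⟩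
  + (N !) / d₂
    ≡⟨ hyperCatalan-typeKK1 j (suc m) 0 ⟨
  hyperCatalan T ∎
  where
  open ≡-Reasoning
  k = 2 + j
  zs = replicate j zero
  T = typeKK1 k (suc m) 0
  N = numDeg T
  W = weighted 1 T
  d₁ = H′-den k (suc m + 0) (suc W) m 0
  d₂ = denDeg T ! * (suc m ! * 0 !)
  instance
    d₁≢0 : NonZero d₁
    d₁≢0 = H′-den≢0 k (suc m + 0) (suc W) m 0
    d₂≢0 : NonZero d₂
    d₂≢0 = m*n≢0 _ _ {{denDeg T !≢0}} {{suc m !* 0 !≢0}}

H-step : ∀ j m n →
  H (2 + j) m (suc n) +ℚ H (2 + j) (suc m) n ≡ hyperCatalan (typeKK1 (2 + j) (suc m) (suc n))
H-step j m n = begin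
  H k m (suc n) +ℚ H k (suc m) n
    ≡⟨ cong₂ _+ℚ_ shifted unshifted ⟩
  + (suc N !) / d₁ +ℚ + (N !) / d₂
    ≡⟨ /-+-/ (suc N !) d₁ (N !) d₂ ⟩
  (+ (suc N ! * d₂ + N ! * d₁) / (d₁ * d₂)) {{m*n≢0 d₁ d₂}}
    ≡⟨ /-cross (suc N ! * d₂ + N ! * d₁) (d₁ * d₂) (N !) d₃ {{m*n≢0 d₁ d₂}}
         (H-step-cleared N W m n (N !) (W !) (m !) (n !) (degree-identity j (suc m) (suc n))) ⟩
  + (N !) / d₃
    ≡⟨ hyperCatalan-typeKK1 j (suc m) (suc n) ⟨
  hyperCatalan T ∎
  where
  open ≡-Reasoning
  k = 2 + j
  zs = replicate j zero
  T = typeKK1 k (suc m) (suc n)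
  N = numDeg T
  W = weighted 1 T
  t = suc m + suc n
  d₁ = H′-den k t (suc W) m (suc n)
  d₂ = H′-den k t W (suc m) n
  d₃ = denDeg T ! * (suc m ! * suc n !)
  instance
    d₁≢0 : NonZero d₁
    d₁≢0 = H′-den≢0 k t (suc W) m (suc n)
    d₂≢0 : NonZero d₂
    d₂≢0 = H′-den≢0 k t W (suc m) n
    d₃≢0 : NonZero d₃
    d₃≢0 = m*n≢0 _ _ {{denDeg T !≢0}} {{suc m !* suc n !≢0}}
  shifted : H k m (suc n) ≡ H′ k t (suc N) (suc W) m (suc n)
  shifted = trans (H≡H′ j m (suc n))
    (H′-cong k {t} m (suc n) refl (weighted-shift 2 zs m (suc n) []) (weighted-shift 1 zs m (suc n) []))
  unshifted : H k (suc m) n ≡ H′ k t N W (suc m) n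
  unshifted = trans (H≡H′ j (suc m) n)
    (H′-cong k {x = N} {y = W} (suc m) n (cong suc (sym (+-suc m n))) refl refl)

module _ {G : Type → ℚ} (isGeode : IsGeode G) (j : ℕ) where
  open IsGeode isGeode
  open ≡-Reasoning

  private
    T : ℕ → ℕ → Type
    T = typeKK1 (2 + j)
    zs = replicate j zero

  geode-base : ∀ m → G (T m 0) ≡ hyperCatalan (T (suc m) 0)
  geode-base m = begin
    G (T m 0)                  ≡⟨ ℚ.+-identityʳ (G (T m 0)) ⟨
    G (T m 0) +ℚ 0ℚ            ≡⟨ shiftSumAux-zeros G j [] (suc m ∷ 0 ∷ []) ⟨
    shiftSum G (T (suc m) 0)   ≡⟨ geodeEq (T (suc m) 0) (isZeroType-++-suc zs m (0 ∷ [])) ⟨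
    hyperCatalan (T (suc m) 0) ∎

  geode-step : ∀ m n → G (T m (suc n)) +ℚ G (T (suc m) n) ≡ hyperCatalan (T (suc m) (suc n))
  geode-step m n = begin
    G (T m (suc n)) +ℚ G (T (suc m) n)
      ≡⟨ cong (λ xs → G (T m (suc n)) +ℚ G xs) (++-assoc zs [ suc m ] (n ∷ [])) ⟨
    G (T m (suc n)) +ℚ G ((zs ++ [ suc m ]) ++ n ∷ [])
      ≡⟨ cong (G (T m (suc n)) +ℚ_) (ℚ.+-identityʳ _) ⟨
    G (T m (suc n)) +ℚ (G ((zs ++ [ suc m ]) ++ n ∷ []) +ℚ 0ℚ)
      ≡⟨ shiftSumAux-zeros G j [] (suc m ∷ suc n ∷ []) ⟨
    shiftSum G (T (suc m) (suc n))
      ≡⟨ geodeEq (T (suc m) (suc n)) (isZeroType-++-suc zs m (suc n ∷ [])) ⟨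
    hyperCatalan (T (suc m) (suc n)) ∎

theorem10 : (G : Type → ℚ) → IsGeode G →
    (k m n : ℕ) → 2 ≤ k → G (typeKK1 k m n) ≡ H k m n
theorem10 G isGeode (suc (suc j)) m n (s≤s (s≤s z≤n)) = G≡H n m
  where
  open ≡-Reasoning
  k = 2 + j
  T = typeKK1 k
  G≡H : ∀ n m → G (T m n) ≡ H k m n
  G≡H zero    m = trans (geode-base isGeode j m) (sym (H-base j m))
  G≡H (suc n) m = ∙-cancelʳ (H k (suc m) n) _ _ (begin
    G (T m (suc n)) +ℚ H k (suc m) n   ≡⟨ cong (G (T m (suc n)) +ℚ_) (G≡H n (suc m)) ⟨
    G (T m (suc n)) +ℚ G (T (suc m) n) ≡⟨ geode-step isGeode j m n ⟩
    hyperCatalan (T (suc m) (suc n))   ≡⟨ H-step j m n ⟨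
    H k m (suc n) +ℚ H k (suc m) n     ∎)
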